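{- If $v\in\{a,b\}^*$ is non-constant, then $h(v)=h(v_+)+1$.
   Context: A word is constant if it is a power of one letter (including $\varepsilon$). For non-constant $u$, ${}_+u$ is the longest suffix of $u$ immediately preceded by the letter different from the first letter of $u$, and $u_+$ is the longest prefix of $u$ immediately followed by the letter different from the last letter of $u$. Height: $v_{(1)}=v$, $v_{(n+1)}={}_+(v_{(n)})$ while $v_{(n)}$ is non-constant; $h(v)$ is the index $h$ such that $v_{(h)}$ is constant. -}

module Defs where

open import Data.Nat using (ℕ; zero; suc)
open import Data.List using (List; []; _∷_; length; reverse)
open import Data.List.Relation.Unary.All using (All; []; _∷_; all?)
import Data.List.Relation.Unary.All as All
open import Data.Product using (∃-syntax; _,_)
open import Relation.Binary.PropositionalEquality using (_≡_; refl; sym; trans)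
open import Relation.Nullary using (Dec; yes; no; does)
open import Data.Bool using (if_then_else_)

data Letter : Set where
  a b : Letter

_≟L_ : (x y : Letter) → Dec (x ≡ y)
a ≟L a = yes refl
a ≟L b = no λ ()
b ≟L a = no λ ()
b ≟L b = yes refl

other : Letter → Letter
other a = b
other b = a

Word : Set
Word = List Letter

Constant : Word → Set
Constant u = ∃[ x ] All (_≡ x) u

constant? : (u : Word) → Dec (Constant u)
constant? [] = yes (a , [])
constant? (x ∷ xs) with all? (_≟L x) xs
... | yes p = yes (x , (refl ∷ p))
... | no ¬p = no λ { (y , (q ∷ qs)) → ¬p (All.map (λ e → trans e (sym q)) qs) }

-- suffix of w after the first occurrence of y (empty if y does not occur)
afterFirst : Letter → Word → Word
afterFirst y [] = []
afterFirst y (z ∷ zs) = if does (z ≟L y) then zs else afterFirst y zs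

-- ₊u : longest suffix of u immediately preceded by the letter different
-- from the first letter of u (meaningful for non-constant u)
₊_ : Word → Word
₊ [] = []
₊ (x ∷ xs) = afterFirst (other x) xs

-- u₊ : longest prefix of u immediately followed by the letter different
-- from the last letter of u (the mirror image of ₊)
_₊ : Word → Word
u ₊ = reverse (₊ (reverse u))

-- height with fuel: iterate ₊ until a constant word is reached,
-- counting the words v_(1), ..., v_(h)
heightFuel : ℕ → Word → ℕ
heightFuel zero u = 1
heightFuel (suc n) u = if does (constant? u) then 1 else suc (heightFuel n (₊ u))

-- h(v): fuel length v suffices since |₊u| < |u| for non-constant u
h : Word → ℕ
h v = heightFuel (length v) v

-- A non-constant v factors as v = x p y w with p ∈ x* and y ≠ x, and then ₊v = w, while
-- v₊ = x p y w₊ as soon as w is non-constant. So ₊(v₊) = (₊v)₊: trimming on the left and on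
-- the right commute, and induction on |v| gives h(v) = h(v₊) + 1. The base case is ₊v constant,
-- where v ∈ x⁺y⁺ ∪ x⁺yx⁺ and v₊ is constant as well.
module Submission where

open import Defs
open import Data.Nat using (_+_; zero; suc; _≤_; s≤s)
open import Data.Nat.Properties using (≤-refl; ≤-trans; m≤n⇒m≤1+n)
open import Data.List using ([]; _∷_; _++_; [_]; length; reverse)
open import Data.List.Properties using (++-assoc; reverse-++; reverse-involutive; unfold-reverse)
open import Data.List.Relation.Unary.All using (All; []; _∷_)
import Data.List.Relation.Unary.All as All
import Data.List.Relation.Unary.All.Properties as All
import Data.List.Relation.Unary.Any.Properties as Any
open import Data.Product using (∃₂; _×_; _,_)
open import Data.Empty using (⊥-elim)
open import Relation.Nullary using (¬_; yes; no)
open import Relation.Binary.PropositionalEquality using (_≡_; refl; sym; trans; cong; subst; module ≡-Reasoning)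

other-≢ : ∀ x → ¬ other x ≡ x
other-≢ a ()
other-≢ b ()

≢⇒≡other : ∀ {x y} → ¬ y ≡ x → y ≡ other x
≢⇒≡other {a} {a} y≢x = ⊥-elim (y≢x refl)
≢⇒≡other {a} {b} _   = refl
≢⇒≡other {b} {a} _   = refl
≢⇒≡other {b} {b} y≢x = ⊥-elim (y≢x refl)

All-reverse : ∀ {P : Letter → Set} {u : Word} → All P u → All P (reverse u)
All-reverse pu = All.tabulate (λ z∈ → All.lookup pu (Any.reverse⁻ z∈))

Constant-reverse : ∀ {u} → Constant u → Constant (reverse u)
Constant-reverse (x , xu) = x , All-reverse xu

nonconstant-reverse : ∀ {u} → ¬ Constant u → ¬ Constant (reverse u)
nonconstant-reverse {u} nc c = nc (subst Constant (reverse-involutive u) (Constant-reverse c))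

nonconstant-∷ : ∀ {y u} → ¬ Constant u → ¬ Constant (y ∷ u)
nonconstant-∷ nc (x , _ ∷ xu) = nc (x , xu)

afterFirst-self : ∀ x u → afterFirst x (x ∷ u) ≡ u
afterFirst-self a u = refl
afterFirst-self b u = refl

afterFirst-++-skip : ∀ {x} p m → All (_≡ x) p → afterFirst (other x) (p ++ m) ≡ afterFirst (other x) m
afterFirst-++-skip         []      m []           = refl
afterFirst-++-skip {x} (z ∷ p) m (refl ∷ xp) with z ≟L other x
... | yes z≡y = ⊥-elim (other-≢ z (sym z≡y))
... | no  _   = afterFirst-++-skip p m xp

All-afterFirst : ∀ {P : Letter → Set} x u → All P u → All P (afterFirst x u)
All-afterFirst x []      []         = []
All-afterFirst x (z ∷ u) (pz ∷ pu) with z ≟L x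
... | yes _ = pu
... | no  _ = All-afterFirst x u pu

All-afterFirst-∷ : ∀ {P : Letter → Set} x z u → All P u → All P (afterFirst x (z ∷ u))
All-afterFirst-∷ x z u pu with z ≟L x
... | yes _ = pu
... | no  _ = All-afterFirst x u pu

length-afterFirst : ∀ x u → length (afterFirst x u) ≤ length u
length-afterFirst x []      = ≤-refl
length-afterFirst x (z ∷ u) with z ≟L x
... | yes _ = m≤n⇒m≤1+n ≤-refl
... | no  _ = m≤n⇒m≤1+n (length-afterFirst x u)

₊-shape : ∀ {x p} w → All (_≡ x) p → ₊ (x ∷ p ++ other x ∷ w) ≡ w
₊-shape {x} {p} w xp = trans (afterFirst-++-skip p (other x ∷ w) xp) (afterFirst-self (other x) w)

shape-nonconstant : ∀ x p w → ¬ Constant (x ∷ p ++ other x ∷ w)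
shape-nonconstant x p w (z , x≡z ∷ zu) with All.++⁻ʳ p zu
... | y≡z ∷ _ = other-≢ x (trans y≡z (sym x≡z))

data Shape : Word → Set where
  shape : ∀ x {p} w → All (_≡ x) p → Shape (x ∷ p ++ other x ∷ w)

firstOther : ∀ x u → ¬ All (_≡ x) u → ∃₂ λ p w → All (_≡ x) p × u ≡ p ++ other x ∷ w
firstOther x []      ¬xu = ⊥-elim (¬xu [])
firstOther x (z ∷ u) ¬xu with z ≟L x
... | no  z≢x  = [] , u , [] , cong (_∷ u) (≢⇒≡other z≢x)
... | yes refl with firstOther x u (λ xu → ¬xu (refl ∷ xu))
...   | p , w , xp , refl = z ∷ p , w , refl ∷ xp , refl

shapeOf : ∀ v → ¬ Constant v → Shape v
shapeOf []      nc = ⊥-elim (nc (a , []))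
shapeOf (x ∷ u) nc with firstOther x u (λ xu → nc (x , refl ∷ xu))
... | p , w , xp , refl = shape x w xp

₊-++ : ∀ {u} m → ¬ Constant u → ₊ (u ++ m) ≡ ₊ u ++ m
₊-++ {u} m nc with shapeOf u nc
... | shape x {p} w xp = begin
  ₊ ((x ∷ p ++ other x ∷ w) ++ m) ≡⟨ cong (λ t → ₊ (x ∷ t)) (++-assoc p (other x ∷ w) m) ⟩
  ₊ (x ∷ p ++ other x ∷ w ++ m)   ≡⟨ ₊-shape (w ++ m) xp ⟩
  w ++ m                          ≡⟨ cong (_++ m) (sym (₊-shape w xp)) ⟩
  ₊ (x ∷ p ++ other x ∷ w) ++ m   ∎
  where open ≡-Reasoning

++-₊ʳ : ∀ {u} m → ¬ Constant u → (m ++ u) ₊ ≡ m ++ u ₊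
++-₊ʳ {u} m nc = begin
  reverse (₊ (reverse (m ++ u)))          ≡⟨ cong (λ t → reverse (₊ t)) (reverse-++ m u) ⟩
  reverse (₊ (reverse u ++ reverse m))    ≡⟨ cong reverse (₊-++ (reverse m) (nonconstant-reverse nc)) ⟩
  reverse (₊ (reverse u) ++ reverse m)    ≡⟨ reverse-++ (₊ (reverse u)) (reverse m) ⟩
  reverse (reverse m) ++ u ₊              ≡⟨ cong (_++ u ₊) (reverse-involutive m) ⟩
  m ++ u ₊                                ∎
  where open ≡-Reasoning

++-∷-₊ʳ : ∀ {w} m y → ¬ Constant w → (m ++ y ∷ w) ₊ ≡ m ++ y ∷ w ₊
++-∷-₊ʳ m y nc = trans (++-₊ʳ m (nonconstant-∷ nc)) (cong (m ++_) (++-₊ʳ [ y ] nc))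

reverse-++-∷ : ∀ (m : Word) y w → reverse (m ++ y ∷ w) ≡ reverse w ++ y ∷ reverse m
reverse-++-∷ m y w = begin
  reverse (m ++ y ∷ w)             ≡⟨ reverse-++ m (y ∷ w) ⟩
  reverse (y ∷ w) ++ reverse m     ≡⟨ cong (_++ reverse m) (unfold-reverse y w) ⟩
  (reverse w ++ [ y ]) ++ reverse m ≡⟨ ++-assoc (reverse w) [ y ] (reverse m) ⟩
  reverse w ++ y ∷ reverse m       ∎
  where open ≡-Reasoning

₊-constant-++-∷ : ∀ {c x : Letter} (r : Word) y q → All (_≡ c) r → All (_≡ x) q →
                  All (_≡ x) (₊ (r ++ y ∷ q))
₊-constant-++-∷ []      y q []          xq = All-afterFirst (other y) q xq
₊-constant-++-∷ (_ ∷ r) y q (refl ∷ cr) xq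
  rewrite afterFirst-++-skip r (y ∷ q) cr = All-afterFirst-∷ _ y q xq

Constant-₊⇒Constant-₊ʳ : ∀ {v} → ¬ Constant v → Constant (₊ v) → Constant (v ₊)
Constant-₊⇒Constant-₊ʳ {v} nc c₊v with shapeOf v nc
... | shape x {p} w xp with subst Constant (₊-shape w xp) c₊v
...   | _ , cw = x , subst (λ t → All (_≡ x) (reverse (₊ t))) (sym (reverse-++-∷ (x ∷ p) (other x) w))
                   (All-reverse (₊-constant-++-∷ (reverse w) (other x) (reverse (x ∷ p))
                                                 (All-reverse cw) (All-reverse (refl ∷ xp))))

nonconstant-₊⇒nonconstant-₊ʳ : ∀ {v} → ¬ Constant v → ¬ Constant (₊ v) → ¬ Constant (v ₊)
nonconstant-₊⇒nonconstant-₊ʳ {v} nc nc₊v with shapeOf v nc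
... | shape x {p} w xp rewrite ₊-shape w xp | ++-∷-₊ʳ (x ∷ p) (other x) nc₊v = shape-nonconstant x p (w ₊)

₊-₊ʳ-comm : ∀ {v} → ¬ Constant v → ¬ Constant (₊ v) → ₊ (v ₊) ≡ (₊ v) ₊
₊-₊ʳ-comm {v} nc nc₊v with shapeOf v nc
... | shape x {p} w xp rewrite ₊-shape w xp | ++-∷-₊ʳ (x ∷ p) (other x) nc₊v = ₊-shape (w ₊) xp

heightFuel-constant : ∀ n {u} → Constant u → heightFuel n u ≡ 1
heightFuel-constant zero    c = refl
heightFuel-constant (suc n) {u} c with constant? u
... | yes _ = refl
... | no nc = ⊥-elim (nc c)

heightFuel-irrelevant : ∀ m n u → length u ≤ m → length u ≤ n → heightFuel m u ≡ heightFuel n u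
heightFuel-irrelevant m n [] _ _ = trans (heightFuel-constant m (a , [])) (sym (heightFuel-constant n (a , [])))
heightFuel-irrelevant (suc m) (suc n) (x ∷ u) (s≤s |u|≤m) (s≤s |u|≤n) with constant? (x ∷ u)
... | yes _ = refl
... | no  _ = cong suc (heightFuel-irrelevant m n (₊ (x ∷ u))
                         (≤-trans (length-afterFirst _ u) |u|≤m) (≤-trans (length-afterFirst _ u) |u|≤n))

h-constant : ∀ {u} → Constant u → h u ≡ 1
h-constant {u} = heightFuel-constant (length u)

h-nonconstant : ∀ {u} → ¬ Constant u → h u ≡ suc (h (₊ u))
h-nonconstant {[]}    nc = ⊥-elim (nc (a , []))
h-nonconstant {x ∷ u} nc with constant? (x ∷ u)
... | yes c = ⊥-elim (nc c)
... | no  _ = cong suc (heightFuel-irrelevant (length u) _ (₊ (x ∷ u)) (length-afterFirst _ u) ≤-refl)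

h≡h-₊ʳ+1 : ∀ n v → length v ≤ n → ¬ Constant v → h v ≡ h (v ₊) + 1
h≡h-₊ʳ+1 _       []      _           nc = ⊥-elim (nc (a , []))
h≡h-₊ʳ+1 (suc n) (x ∷ u) (s≤s |u|≤n) nc with constant? (₊ (x ∷ u))
... | yes c₊v = begin
  h v               ≡⟨ h-nonconstant nc ⟩
  suc (h (₊ v))     ≡⟨ cong suc (h-constant c₊v) ⟩
  2                 ≡⟨ cong (_+ 1) (sym (h-constant (Constant-₊⇒Constant-₊ʳ nc c₊v))) ⟩
  h (v ₊) + 1       ∎
  where open ≡-Reasoning
        v = x ∷ u
... | no nc₊v = begin
  h v                   ≡⟨ h-nonconstant nc ⟩
  suc (h (₊ v))         ≡⟨ cong suc (h≡h-₊ʳ+1 n (₊ v) (≤-trans (length-afterFirst _ u) |u|≤n) nc₊v) ⟩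
  suc (h ((₊ v) ₊)) + 1 ≡⟨ cong (λ t → suc (h t) + 1) (sym (₊-₊ʳ-comm nc nc₊v)) ⟩
  suc (h (₊ (v ₊))) + 1 ≡⟨ cong (_+ 1) (sym (h-nonconstant (nonconstant-₊⇒nonconstant-₊ʳ nc nc₊v))) ⟩
  h (v ₊) + 1           ∎
  where open ≡-Reasoning
        v = x ∷ u

mainTheorem13 : (v : Word) → ¬ Constant v → h v ≡ h (v ₊) + 1
mainTheorem13 v = h≡h-₊ʳ+1 (length v) v ≤-refl
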